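{- Let $T$ be a tree and let $u,v\in V(T)$ be vertices with $d(u)\ge 3$ such that $v$ is a vertex of degree at least $3$ nearest to $u$ (among vertices other than $u$), and $d(u,v)\ge 3$. Let the $u$–$v$ path be $u\sim u_2\sim\cdots\sim v_2\sim v$ (so $u_2\ne v_2$ are the neighbours of $u$ and $v$ on this path). Write $N(u)=\{u_1,u_2,\dots,u_m\}$ and $N(v)=\{v_1,v_2,\dots,v_n\}$, and assume $m\ge n$. Let $T^*$ be the graph obtained from $T$ by deleting the edges $vv_i$ and adding the edges $uv_i$ for all $3\le i\le n$. Then $SO(T^*)>SO(T)$.
   Context: For a graph $G$ with vertex degrees $d(\cdot)$, the Sombor index is $SO(G)=\sum_{xy\in E(G)}\sqrt{d(x)^2+d(y)^2}$, the sum running over all edges. $N(x)$ denotes the set of neighbours of $x$ and $d(x,y)$ the distance between $x$ and $y$. -}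

module Defs where

open import Data.Nat using (ℕ; zero; suc; _+_; _*_; _≤_; _<_; _≤ᵇ_)
open import Data.Bool using (Bool; true; false; if_then_else_; _∧_; _∨_; not)
open import Data.Fin using (Fin; toℕ; _≟_)
open import Data.List using (List; []; _∷_; map; concatMap; allFin)
open import Data.Nat.ListAction using (sum)
open import Data.Product using (Σ; _×_; ∃-syntax)
open import Relation.Binary.PropositionalEquality using (_≡_)
open import Relation.Nullary using (does)
open import Data.Sum using (_⊎_)
open import Function.Definitions using (Injective)

Graph : ℕ → Set
Graph N = Fin N → Fin N → Bool

_≡ᵇ_ : ∀ {N} → Fin N → Fin N → Bool
x ≡ᵇ y = does (x ≟ y)

IsSimple : ∀ {N} → Graph N → Set
IsSimple {N} G = (∀ (x y : Fin N) → G x y ≡ G y x) × (∀ (x : Fin N) → G x x ≡ false)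

deg : ∀ {N} → Graph N → Fin N → ℕ
deg {N} G x = sum (map (λ y → if G x y then 1 else 0) (allFin N))

data Walk {N} (G : Graph N) : Fin N → Fin N → ℕ → Set where
  here : ∀ {x} → Walk G x x 0
  step : ∀ {x y z k} → G x y ≡ true → Walk G y z k → Walk G x z (suc k)

Connected : ∀ {N} → Graph N → Set
Connected {N} G = ∀ (x y : Fin N) → ∃[ k ] Walk G x y k

IsCycle : ∀ {N} → Graph N → (L : ℕ) → (Fin L → Fin N) → Set
IsCycle {N} G L f =
  (3 ≤ L) × Injective _≡_ _≡_ f ×
  (∀ (i j : Fin L) → (suc (toℕ i) ≡ toℕ j ⊎ (suc (toℕ i) ≡ L × toℕ j ≡ 0)) → G (f i) (f j) ≡ true)

Acyclic : ∀ {N} → Graph N → Set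
Acyclic {N} G = ∀ (L : ℕ) (f : Fin L → Fin N) → IsCycle G L f → Data.Empty.⊥
  where import Data.Empty

IsTree : ∀ {N} → Graph N → Set
IsTree G = IsSimple G × Connected G × Acyclic G

HasDist : ∀ {N} → Graph N → Fin N → Fin N → ℕ → Set
HasDist G x y k = Walk G x y k × (∀ j → Walk G x y j → k ≤ j)

-- T* : delete edges v w and add edges u w for every neighbour w of v other than v1, v2
moved : ∀ {N} → Graph N → Fin N → Fin N → Fin N → Fin N → Bool
moved G v v1 v2 w = G v w ∧ not (w ≡ᵇ v1) ∧ not (w ≡ᵇ v2)

transform : ∀ {N} → Graph N → (u v v1 v2 : Fin N) → Graph N
transform G u v v1 v2 x y =
  (G x y ∧ not ((x ≡ᵇ v ∧ moved G v v1 v2 y) ∨ (y ≡ᵇ v ∧ moved G v v1 v2 x)))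
  ∨ ((x ≡ᵇ u ∧ moved G v v1 v2 y) ∨ (y ≡ᵇ u ∧ moved G v v1 v2 x))

edgeTerms : ∀ {N} → Graph N → List ℕ
edgeTerms {N} G = concatMap (λ x → concatMap (λ y →
    if G x y ∧ (suc (toℕ x) ≤ᵇ toℕ y)
    then (deg G x * deg G x + deg G y * deg G y) ∷ [] else []) (allFin N)) (allFin N)

isqrt : ℕ → ℕ
isqrt zero = zero
isqrt (suc n) with isqrt n
... | r = if suc r * suc r ≤ᵇ suc n then suc r else r

-- Strict order of sums of square roots of naturals:
-- Σ_{a ∈ as} √a < Σ_{b ∈ bs} √b, in the constructive (Bishop) sense: there is a
-- scale k such that the upper approximation Σ (⌊k√a⌋ + 1) of k·Σ√a is strictly
-- below the lower approximation Σ ⌊k√b⌋ of k·Σ√b.  (⌊k√a⌋ = isqrt (a k²).)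
SqrtSum< : List ℕ → List ℕ → Set
SqrtSum< as bs = ∃[ k ]
  (sum (map (λ a → suc (isqrt (a * (k * k)))) as) < sum (map (λ b → isqrt (b * (k * k))) bs))

SO< : ∀ {N} → Graph N → Graph N → Set
SO< G H = SqrtSum< (edgeTerms G) (edgeTerms H)

-- Write m = d(u), n = d(v) and q for the number of edges moved from v to u.  Fix a scale K and
-- compare the approximations ⌊K√w⌋ of the edge terms √w edge by edge.  Edges avoiding u and v
-- keep their weight and lose at most 1 to rounding.  The q ≥ 1 moved edges only get heavier,
-- since u ends with degree m + q ≥ n.  The at most two edges left at v lose at most q each,
-- because x ↦ √(x² + d²) is 1-Lipschitz.  Every neighbour of u has degree at most 2 (v is the
-- nearest vertex of degree ≥ 3), and for such edges raising the degree of u from m ≥ 3 to m + q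
-- adds at least 5q/6.  The net gain 3 · 5q/6 − 2q = q/2 per unit of scale beats the rounding
-- loss once K is of order N².
{-# OPTIONS --safe #-}
module Submission where

open import Defs
open import Data.Bool using (Bool; true; false; if_then_else_; _∧_; _∨_; not; T)
open import Data.Bool.Properties using (∧-comm; ∨-comm; ∧-zeroʳ; ∧-identityʳ; ∨-identityʳ; ¬-not)
open import Data.Fin using (Fin; toℕ; _≟_)
open import Data.Fin.Properties using (punchInᵢ≢i; toℕ-injective)
open import Data.List using (List; []; _∷_; _++_; map; concatMap; allFin; tabulate)
open import Data.List.Properties using (map-tabulate; map-++)
import Data.Nat.ListAction as List
open import Data.Nat.ListAction.Properties using (sum-++)
open import Data.Nat using (ℕ; zero; suc; _+_; _*_; _∸_; _≤_; _<_; _<ᵇ_; _≤ᵇ_; _≤?_; z≤n; s≤s)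
open import Data.Nat.Properties hiding (_≟_; ≡ᵇ⇒≡)
open import Algebra.Properties.CommutativeSemigroup +-commutativeSemigroup using (xy∙z≈xz∙y; interchange)
open import Algebra.Properties.Semiring.Sum +-*-semiring
  using (sum; sum-syntax; sum-cong-≗; ∑-distrib-+; sum-remove; sum-replicate-zero; *-distribʳ-sum)
open import Data.Nat.Tactic.RingSolver using (solve; solve-∀)
open import Data.Product using (_×_; _,_; proj₁; proj₂)
open import Data.Vec.Functional using (removeAt; replicate)
open import Function using (_∘_; id)
open import Relation.Binary.Definitions using (tri<; tri≈; tri>)
open import Relation.Binary.PropositionalEquality
open import Relation.Nullary using (¬_; yes; no)
open import Relation.Nullary.Decidable using (dec-true; dec-false)
open import Relation.Nullary.Negation using (contradiction)

-- Indicator weights and finite sums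

_when_ : ℕ → Bool → ℕ
n when b = if b then n else 0

infixl 5 _when_

χ : Bool → ℕ
χ b = 1 when b

zero-when : ∀ b → 0 when b ≡ 0
zero-when true = refl
zero-when false = refl

χ-* : ∀ b c → χ b * c ≡ c when b
χ-* true c = +-identityʳ c
χ-* false c = refl

suc-when-≤ : ∀ n b → suc n when b ≤ (n when b) + 1
suc-when-≤ n true = ≤-reflexive (+-comm 1 n)
suc-when-≤ n false = z≤n

χ-∧ : ∀ a b → χ (a ∧ b) ≡ χ b when a
χ-∧ true b = refl
χ-∧ false b = refl

when-∧ : ∀ n a b → n when a ∧ b ≡ n when a when b
when-∧ n true b = refl
when-∧ n false true = refl
when-∧ n false false = refl

∧-elimˡ : ∀ {a b} → a ∧ b ≡ true → a ≡ true
∧-elimˡ {true} _ = refl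

∧-elimʳ : ∀ {a b} → a ∧ b ≡ true → b ≡ true
∧-elimʳ {true} b = b

χ-∨ : ∀ a b → (b ≡ true → a ≡ false) → χ (a ∨ b) ≡ χ a + χ b
χ-∨ true  true  b⇒¬a = contradiction (b⇒¬a refl) λ ()
χ-∨ true  false _    = refl
χ-∨ false b     _    = refl

χ-∧-not : ∀ a b → (b ≡ true → a ≡ true) → χ a ≡ χ (a ∧ not b) + χ b
χ-∧-not true  true  _    = refl
χ-∧-not true  false _    = refl
χ-∧-not false true  b⇒a = contradiction (b⇒a refl) λ ()
χ-∧-not false false _    = refl

-- Degree bookkeeping for a vertex that trades the neighbour marked by a for the one marked by b.
χ-reroute : ∀ g a b → (a ≡ true → g ≡ true) → (b ≡ true → g ≡ false) →
            χ ((g ∧ not a) ∨ b) + χ a ≡ χ g + χ b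
χ-reroute true  true  true  _   b⇒¬g = contradiction (b⇒¬g refl) λ ()
χ-reroute true  true  false _   _    = refl
χ-reroute true  false true  _   b⇒¬g = contradiction (b⇒¬g refl) λ ()
χ-reroute true  false false _   _    = refl
χ-reroute false true  b     a⇒g _    = contradiction (a⇒g refl) λ ()
χ-reroute false false true  _   _    = refl
χ-reroute false false false _   _    = refl

χ-kept-≤ : ∀ g a b → χ (g ∧ not (g ∧ not a ∧ not b)) ≤ χ a + χ b
χ-kept-≤ true  true  b     = s≤s z≤n
χ-kept-≤ true  false true  = s≤s z≤n
χ-kept-≤ true  false false = z≤n
χ-kept-≤ false a     b     = z≤n

∑-mono-≤ : ∀ {n} {f g : Fin n → ℕ} → (∀ i → f i ≤ g i) → ∑[ i < n ] f i ≤ ∑[ i < n ] g i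
∑-mono-≤ {zero} f≤g = z≤n
∑-mono-≤ {suc n} f≤g = +-mono-≤ (f≤g Fin.zero) (∑-mono-≤ (f≤g ∘ Fin.suc))
  where import Data.Fin as Fin

∑-const : ∀ n c → ∑[ i < n ] c ≡ n * c
∑-const zero c = refl
∑-const (suc n) c = cong (c +_) (∑-const n c)

∑-point : ∀ {n} (f : Fin n → ℕ) i → (∀ j → j ≢ i → f j ≡ 0) → ∑[ j < n ] f j ≡ f i
∑-point {suc n} f i vanishes = begin
  sum f                          ≡⟨ sum-remove f ⟩
  f i + sum (removeAt f i)       ≡⟨ cong (f i +_) (sum-cong-≗ {n} {removeAt f i} {replicate n 0}
                                                              (λ j → vanishes _ (punchInᵢ≢i i j))) ⟩
  f i + sum (replicate n 0)      ≡⟨ cong (f i +_) (sum-replicate-zero n) ⟩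
  f i + 0                        ≡⟨ +-identityʳ (f i) ⟩
  f i                            ∎
  where open ≡-Reasoning

∑-when : ∀ {n} (b : Fin n → Bool) c → ∑[ i < n ] (c when b i) ≡ ∑[ i < n ] χ (b i) * c
∑-when b c = sym (trans (*-distribʳ-sum c (χ ∘ b)) (sum-cong-≗ (λ i → χ-* (b i) c)))

-- Sums over unordered pairs

_≺_ : ∀ {N} → Fin N → Fin N → Bool
x ≺ y = toℕ x <ᵇ toℕ y

infix 7 _≺_

≺⇒< : ∀ {N} {x y : Fin N} → (x ≺ y) ≡ true → toℕ x < toℕ y
≺⇒< {x = x} {y} x≺y = <ᵇ⇒< (toℕ x) (toℕ y) (subst T (sym x≺y) _)

<⇒≺ : ∀ {N} {x y : Fin N} → toℕ x < toℕ y → (x ≺ y) ≡ true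
<⇒≺ {x = x} {y} x<y with x ≺ y | <⇒<ᵇ x<y
... | true | _ = refl

≺-irrefl : ∀ {N} (x : Fin N) → (x ≺ x) ≡ false
≺-irrefl x with x ≺ x in x≺x
... | true = contradiction (≺⇒< x≺x) (n≮n (toℕ x))
... | false = refl

when-≺-+-when-≻ : ∀ {N} {x y : Fin N} n → x ≢ y → (n when x ≺ y) + (n when y ≺ x) ≡ n
when-≺-+-when-≻ {x = x} {y} n x≢y with x ≺ y in x≺y | y ≺ x in y≺x
... | true  | true  = contradiction (≺⇒< {x = y} {x} y≺x) (<⇒≯ (≺⇒< {x = x} {y} x≺y))
... | true  | false = +-identityʳ n
... | false | true  = refl
... | false | false with <-cmp (toℕ x) (toℕ y)
...   | tri< x<y _ _ = contradiction (trans (sym (<⇒≺ x<y)) x≺y) λ ()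
...   | tri≈ _ x≡y _ = contradiction (toℕ-injective x≡y) x≢y
...   | tri> _ _ y<x = contradiction (trans (sym (<⇒≺ y<x)) y≺x) λ ()

≡ᵇ-refl : ∀ {N} (x : Fin N) → (x ≡ᵇ x) ≡ true
≡ᵇ-refl x = dec-true (x ≟ x) refl

≢⇒≡ᵇ-false : ∀ {N} {x y : Fin N} → x ≢ y → (x ≡ᵇ y) ≡ false
≢⇒≡ᵇ-false {x = x} {y} = dec-false (x ≟ y)

≡ᵇ⇒≡ : ∀ {N} {x y : Fin N} → (x ≡ᵇ y) ≡ true → x ≡ y
≡ᵇ⇒≡ {x = x} {y} x≡ᵇy with x ≟ y
... | yes x≡y = x≡y

∑-when-≡ᵇ : ∀ {N} (p : Fin N) n → ∑[ y < N ] (n when y ≡ᵇ p) ≡ n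
∑-when-≡ᵇ p n = trans (∑-point (λ y → n when y ≡ᵇ p) p (λ y y≢p → cong (n when_) (≢⇒≡ᵇ-false y≢p)))
                      (cong (n when_) (≡ᵇ-refl p))

∑-χ-≡ᵇ-∧ : ∀ {N} (p : Fin N) b → ∑[ y < N ] χ (y ≡ᵇ p ∧ b) ≡ χ b
∑-χ-≡ᵇ-∧ p b = trans (sum-cong-≗ (λ y → χ-∧ (y ≡ᵇ p) b)) (∑-when-≡ᵇ p (χ b))

∑∑-distrib-+ : ∀ {N} (f g : Fin N → Fin N → ℕ) →
               ∑[ x < N ] ∑[ y < N ] (f x y + g x y) ≡ ∑[ x < N ] ∑[ y < N ] f x y + ∑[ x < N ] ∑[ y < N ] g x y
∑∑-distrib-+ {N} f g =
  trans (sum-cong-≗ (λ x → ∑-distrib-+ (f x) (g x))) (∑-distrib-+ (λ x → ∑[ y < N ] f x y) (λ x → ∑[ y < N ] g x y))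

pairSum : ∀ {N} → (Fin N → Fin N → ℕ) → ℕ
pairSum {N} w = ∑[ x < N ] ∑[ y < N ] (w x y when x ≺ y)

away : ∀ {N} → Fin N → (Fin N → Fin N → ℕ) → Fin N → Fin N → ℕ
away p w x y = w x y when not (x ≡ᵇ p) ∧ not (y ≡ᵇ p)

when-split : ∀ n a b c → (a ≡ true → b ≡ true → c ≡ false) →
             n when c ≡ (n when not a ∧ not b when c) + (n when a ∧ c) + (n when b ∧ c)
when-split n true  true  c     a∧b⇒¬c rewrite a∧b⇒¬c refl refl = refl
when-split n true  false true  _ = sym (+-identityʳ n)
when-split n true  false false _ = refl
when-split n false true  true  _ = refl
when-split n false true  false _ = refl
when-split n false false true  _ = sym (trans (+-identityʳ _) (+-identityʳ n))
when-split n false false false _ = refl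

pairSum-star : ∀ {N} (w : Fin N → Fin N → ℕ) p → (∀ z → w z p ≡ w p z) → w p p ≡ 0 →
               pairSum w ≡ ∑[ z < N ] w p z + pairSum (away p w)
pairSum-star {N} w p w-sym w-pp = begin
  pairSum w
    ≡⟨ sum-cong-≗ (λ x → sum-cong-≗ (λ y → when-split (w x y) (x ≡ᵇ p) (y ≡ᵇ p) (x ≺ y) (both-p x y))) ⟩
  ∑∑ (λ x y → away-p x y + row x y + column x y)
    ≡⟨ trans (∑∑-distrib-+ (λ x y → away-p x y + row x y) column) (cong (_+ ∑∑ column) (∑∑-distrib-+ away-p row)) ⟩
  pairSum (away p w) + ∑∑ row + ∑∑ column
    ≡⟨ cong₂ (λ a b → pairSum (away p w) + a + b) row-p column-p ⟩
  pairSum (away p w) + ∑[ z < N ] (w p z when p ≺ z) + ∑[ z < N ] (w p z when z ≺ p)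
    ≡⟨ +-assoc (pairSum (away p w)) (∑[ z < N ] (w p z when p ≺ z)) (∑[ z < N ] (w p z when z ≺ p)) ⟩
  pairSum (away p w) + (∑[ z < N ] (w p z when p ≺ z) + ∑[ z < N ] (w p z when z ≺ p))
    ≡⟨ cong (pairSum (away p w) +_) (∑-distrib-+ (λ z → w p z when p ≺ z) (λ z → w p z when z ≺ p)) ⟨
  pairSum (away p w) + ∑[ z < N ] ((w p z when p ≺ z) + (w p z when z ≺ p))
    ≡⟨ cong (pairSum (away p w) +_) (sum-cong-≗ star) ⟩
  pairSum (away p w) + ∑[ z < N ] w p z
    ≡⟨ +-comm (pairSum (away p w)) (∑[ z < N ] w p z) ⟩
  ∑[ z < N ] w p z + pairSum (away p w) ∎
  where
  open ≡-Reasoning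
  ∑∑ : (Fin N → Fin N → ℕ) → ℕ
  ∑∑ f = ∑[ x < N ] ∑[ y < N ] f x y
  away-p row column : Fin N → Fin N → ℕ
  away-p x y = away p w x y when x ≺ y
  row x y = w x y when x ≡ᵇ p ∧ x ≺ y
  column x y = w x y when y ≡ᵇ p ∧ x ≺ y
  both-p : ∀ x y → (x ≡ᵇ p) ≡ true → (y ≡ᵇ p) ≡ true → (x ≺ y) ≡ false
  both-p x y x≡p y≡p with ≡ᵇ⇒≡ {x = x} {p} x≡p | ≡ᵇ⇒≡ {x = y} {p} y≡p
  ... | refl | refl = ≺-irrefl p
  row-p : ∑∑ row ≡ ∑[ z < N ] (w p z when p ≺ z)
  row-p = trans (∑-point _ p off-p) (sum-cong-≗ (λ z → cong (λ b → w p z when b ∧ p ≺ z) (≡ᵇ-refl p)))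
    where
    off-p : ∀ x → x ≢ p → ∑[ y < N ] row x y ≡ 0
    off-p x x≢p rewrite ≢⇒≡ᵇ-false x≢p = sum-replicate-zero N
  column-p : ∑∑ column ≡ ∑[ z < N ] (w p z when z ≺ p)
  column-p = sum-cong-≗ λ z → begin
    ∑[ y < N ] column z y
      ≡⟨ ∑-point (column z) p (λ y y≢p → cong (λ b → w z y when b ∧ z ≺ y) (≢⇒≡ᵇ-false y≢p)) ⟩
    w z p when p ≡ᵇ p ∧ z ≺ p            ≡⟨ cong₂ (λ a b → a when b ∧ z ≺ p) (w-sym z) (≡ᵇ-refl p) ⟩
    w p z when z ≺ p                     ∎
  star : ∀ z → (w p z when p ≺ z) + (w p z when z ≺ p) ≡ w p z
  star z with z ≟ p
  ... | yes refl rewrite ≺-irrefl z = sym w-pp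
  ... | no z≢p = when-≺-+-when-≻ (w p z) (z≢p ∘ sym)

pairSum-star₂ : ∀ {N} (w : Fin N → Fin N → ℕ) {u v} → u ≢ v → (∀ x y → w x y ≡ w y x) →
                w u u ≡ 0 → w v v ≡ 0 → w u v ≡ 0 →
                pairSum w ≡ ∑[ z < N ] w u z + ∑[ z < N ] w v z + pairSum (away v (away u w))
pairSum-star₂ {N} w {u} {v} u≢v w-sym w-uu w-vv w-uv = begin
  pairSum w
    ≡⟨ pairSum-star w u (λ z → w-sym z u) w-uu ⟩
  ∑[ z < N ] w u z + pairSum (away u w)
    ≡⟨ cong (∑[ z < N ] w u z +_) (pairSum-star (away u w) v away-sym away-vv) ⟩
  ∑[ z < N ] w u z + (∑[ z < N ] away u w v z + pairSum (away v (away u w)))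
    ≡⟨ cong (λ s → ∑[ z < N ] w u z + (s + pairSum (away v (away u w)))) (sum-cong-≗ away-at-v) ⟩
  ∑[ z < N ] w u z + (∑[ z < N ] w v z + pairSum (away v (away u w)))
    ≡⟨ +-assoc (∑[ z < N ] w u z) (∑[ z < N ] w v z) (pairSum (away v (away u w))) ⟨
  ∑[ z < N ] w u z + ∑[ z < N ] w v z + pairSum (away v (away u w)) ∎
  where
  open ≡-Reasoning
  away-sym : ∀ z → away u w z v ≡ away u w v z
  away-sym z = cong₂ _when_ (w-sym z v) (∧-comm (not (z ≡ᵇ u)) (not (v ≡ᵇ u)))
  away-vv : away u w v v ≡ 0
  away-vv rewrite w-vv = zero-when _
  away-at-v : ∀ z → away u w v z ≡ w v z
  away-at-v z rewrite ≢⇒≡ᵇ-false (u≢v ∘ sym) with z ≟ u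
  ... | yes refl = sym (trans (w-sym v u) w-uv)
  ... | no _ = refl

pairSum-≤-+1 : ∀ {N} {a b : Fin N → Fin N → ℕ} → (∀ x y → a x y ≤ b x y + 1) → pairSum a ≤ pairSum b + N * N
pairSum-≤-+1 {N} {a} {b} a≤b+1 = begin
  pairSum a
    ≤⟨ ∑-mono-≤ (λ x → ∑-mono-≤ (λ y → pointwise x y (x ≺ y))) ⟩
  ∑[ x < N ] ∑[ y < N ] ((b x y when x ≺ y) + 1)
    ≡⟨ ∑∑-distrib-+ (λ x y → b x y when x ≺ y) (λ _ _ → 1) ⟩
  pairSum b + ∑[ x < N ] ∑[ y < N ] 1
    ≡⟨ cong (pairSum b +_) (trans (sum-cong-≗ {N} {λ _ → ∑[ y < N ] 1} {λ _ → N * 1} (λ _ → ∑-const N 1))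
                                  (∑-const N (N * 1))) ⟩
  pairSum b + N * (N * 1)
    ≡⟨ cong (λ n → pairSum b + N * n) (*-identityʳ N) ⟩
  pairSum b + N * N ∎
  where
  open ≤-Reasoning
  pointwise : ∀ x y c → a x y when c ≤ (b x y when c) + 1
  pointwise x y true = a≤b+1 x y
  pointwise x y false = z≤n

away-≤-+1 : ∀ {N} {a b : Fin N → Fin N → ℕ} p x y → (x ≢ p → y ≢ p → a x y ≤ b x y + 1) →
            away p a x y ≤ away p b x y + 1
away-≤-+1 p x y ab with x ≟ p | y ≟ p
... | yes _   | _       = z≤n
... | no _    | yes _   = z≤n
... | no x≢p  | no y≢p  = ab x≢p y≢p

-- Integer square roots

isqrt-spec : ∀ n → isqrt n * isqrt n ≤ n × n < suc (isqrt n) * suc (isqrt n)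
isqrt-spec zero = z≤n , s≤s z≤n
isqrt-spec (suc n) = next (isqrt n) (isqrt-spec n)
  where
  next : ∀ r → r * r ≤ n × n < suc r * suc r →
         let r′ = if suc r * suc r ≤ᵇ suc n then suc r else r
         in r′ * r′ ≤ suc n × suc n < suc r′ * suc r′
  next r (r²≤n , n<r⁺²) with suc r * suc r ≤ᵇ suc n in grows
  ... | true  = ≤ᵇ⇒≤ _ _ (subst T (sym grows) _) , ≤-<-trans n<r⁺² (*-mono-< (n<1+n (suc r)) (n<1+n (suc r)))
  ... | false = m≤n⇒m≤1+n r²≤n , ≰⇒> (λ r⁺²≤n⁺ → subst T grows (≤⇒≤ᵇ r⁺²≤n⁺))

≤-isqrt : ∀ {r n} → r * r ≤ n → r ≤ isqrt n
≤-isqrt {r} {n} r²≤n with r ≤? isqrt n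
... | yes r≤ = r≤
... | no r≰ = contradiction (≤-trans (*-mono-≤ (≰⇒> r≰) (≰⇒> r≰)) r²≤n) (<⇒≱ (proj₂ (isqrt-spec n)))

isqrt-< : ∀ {r n} → n < r * r → isqrt n < r
isqrt-< {r} {n} n<r² with r ≤? isqrt n
... | no r≰ = ≰⇒> r≰
... | yes r≤ = contradiction (≤-trans (*-mono-≤ r≤ r≤) (proj₁ (isqrt-spec n))) (<⇒≱ n<r²)

isqrt-mono-≤ : ∀ {m n} → m ≤ n → isqrt m ≤ isqrt n
isqrt-mono-≤ {m} m≤n = ≤-isqrt (≤-trans (proj₁ (isqrt-spec m)) m≤n)

+-square : ∀ a b → (a + b) * (a + b) ≡ a * a + (2 * a * b + b * b)
+-square = solve-∀

root : ℕ → ℕ → ℕ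
root K a = isqrt (a * (K * K))

m*m≤n*n⇒m≤n : ∀ {a b} → a * a ≤ b * b → a ≤ b
m*m≤n*n⇒m≤n {a} {b} a²≤b² with a ≤? b
... | yes a≤b = a≤b
... | no a≰b = contradiction (*-mono-< (≰⇒> a≰b) (≰⇒> a≰b)) (≤⇒≯ a²≤b²)

-- x ↦ √(x² + d²) is 1-Lipschitz.
root-+-≤ : ∀ K c q d → root K ((c + q) * (c + q) + d * d) ≤ root K (c * c + d * d) + q * K
root-+-≤ K c q d = ≤-pred (isqrt-< B<[R+qK]²)
  where
  A = (c * c + d * d) * (K * K)
  B = ((c + q) * (c + q) + d * d) * (K * K)
  R = suc (root K (c * c + d * d))
  A<R² : A < R * R
  A<R² = proj₂ (isqrt-spec A)
  cK≤R : c * K ≤ R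
  cK≤R = m*m≤n*n⇒m≤n (<⇒≤ (≤-<-trans [cK]²≤A A<R²))
    where
    [cK]²≤A : (c * K) * (c * K) ≤ A
    [cK]²≤A = begin
      (c * K) * (c * K)         ≡⟨ solve (c ∷ K ∷ []) ⟩
      (c * c) * (K * K)         ≤⟨ *-monoˡ-≤ (K * K) (m≤m+n (c * c) (d * d)) ⟩
      A                         ∎
      where open ≤-Reasoning
  B<[R+qK]² : B < (R + q * K) * (R + q * K)
  B<[R+qK]² = begin-strict
    ((c + q) * (c + q) + d * d) * (K * K)
      ≡⟨ solve (c ∷ q ∷ d ∷ K ∷ []) ⟩
    (c * c + d * d) * (K * K) + (2 * (c * K) * (q * K) + (q * K) * (q * K))
      <⟨ +-mono-<-≤ A<R² (+-monoˡ-≤ _ (*-monoˡ-≤ (q * K) (*-monoʳ-≤ 2 cK≤R))) ⟩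
    R * R + (2 * R * (q * K) + (q * K) * (q * K))
      ≡⟨ +-square R (q * K) ⟨
    (R + q * K) * (R + q * K) ∎
    where open ≤-Reasoning

-- For a ≥ 3 and d ≤ 2, √((a + q)² + d²) − √(a² + d²) ≥ 5q/6; the worst case a = 3, d = 2, q = 1
-- gives √20 − √13 ≈ 0.866.
root-+-≥ : ∀ M {a q d} → 3 ≤ a → 1 ≤ q → d ≤ 2 →
           root (6 * M) (a * a + d * d) + 5 * M * q ≤ root (6 * M) ((a + q) * (a + q) + d * d)
root-+-≥ M {a@(suc (suc (suc x)))} {q@(suc y)} {d} (s≤s (s≤s (s≤s _))) (s≤s _) d≤2 = ≤-isqrt (begin
  (s + t) * (s + t)
    ≡⟨ +-square s t ⟩
  s * s + (2 * s * t + t * t)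
    ≤⟨ +-mono-≤ s²≤A (+-monoˡ-≤ (t * t) (*-monoˡ-≤ t (*-monoʳ-≤ 2 s≤))) ⟩
  A + (2 * ((6 * a + 4) * M) * t + t * t)
    ≤⟨ +-monoʳ-≤ A (m≤m+n _ (M * M * (12 * x * q + 7 + 18 * y + 11 * y * y))) ⟩
  A + (2 * ((6 * a + 4) * M) * t + t * t + M * M * (12 * x * q + 7 + 18 * y + 11 * y * y))
    ≡⟨ cong (A +_) expand ⟩
  (a * a + d * d) * (6 * M * (6 * M)) + (2 * a * q + q * q) * (6 * M * (6 * M))
    ≡⟨ solve (x ∷ y ∷ d ∷ M ∷ []) ⟩
  ((a + q) * (a + q) + d * d) * (6 * M * (6 * M)) ∎)
  where
  open ≤-Reasoning
  A = (a * a + d * d) * (6 * M * (6 * M))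
  s = root (6 * M) (a * a + d * d)
  t = 5 * M * q
  s²≤A : s * s ≤ A
  s²≤A = proj₁ (isqrt-spec A)
  -- With a = 3 + x and q = 1 + y the slack terms here and in s≤ have nonnegative coefficients.
  expand : 2 * ((6 * a + 4) * M) * (5 * M * q) + (5 * M * q) * (5 * M * q)
             + M * M * (12 * x * q + 7 + 18 * y + 11 * y * y)
           ≡ (2 * a * q + q * q) * (6 * M * (6 * M))
  expand = solve (x ∷ y ∷ M ∷ [])
  s≤ : s ≤ (6 * a + 4) * M
  s≤ = m*m≤n*n⇒m≤n (begin
    s * s                                                          ≤⟨ s²≤A ⟩
    A                                                              ≤⟨ *-monoˡ-≤ (6 * M * (6 * M)) (+-monoʳ-≤ (a * a) (*-mono-≤ d≤2 d≤2)) ⟩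
    (a * a + 2 * 2) * (6 * M * (6 * M))                            ≤⟨ m≤m+n _ ((48 * x + 16) * (M * M)) ⟩
    (a * a + 2 * 2) * (6 * M * (6 * M)) + (48 * x + 16) * (M * M)  ≡⟨ solve (x ∷ M ∷ []) ⟩
    (6 * a + 4) * M * ((6 * a + 4) * M)                            ∎)

rounding-budget : ∀ L {m c q} → 3 ≤ m → c ≤ 2 → 1 ≤ q → L + c * (q * (6 * suc L)) < m * (5 * suc L * q)
rounding-budget L {m} {c} {q@(suc q′)} 3≤m c≤2 (s≤s _) = begin-strict
  L + c * (q * (6 * suc L))               ≤⟨ +-monoʳ-≤ L (*-monoˡ-≤ (q * (6 * suc L)) c≤2) ⟩
  L + 2 * (q * (6 * suc L))               <⟨ +-monoˡ-< (2 * (q * (6 * suc L))) (n<1+n L) ⟩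
  suc L + 2 * (q * (6 * suc L))           ≤⟨ +-monoˡ-≤ _ (≤-trans (m≤n*m (suc L) 3) (m≤m*n (3 * suc L) q)) ⟩
  3 * suc L * q + 2 * (q * (6 * suc L))   ≡⟨ solve (L ∷ q′ ∷ []) ⟩
  3 * (5 * suc L * q)                     ≤⟨ *-monoˡ-≤ (5 * suc L * q) 3≤m ⟩
  m * (5 * suc L * q)                     ∎
  where open ≤-Reasoning

-- Sombor sums of a graph

sum-tabulate : ∀ {n} (f : Fin n → ℕ) → List.sum (tabulate f) ≡ ∑[ i < n ] f i
sum-tabulate {zero} f = refl
sum-tabulate {suc n} f = cong (f Fin.zero +_) (sum-tabulate (f ∘ Fin.suc))
  where import Data.Fin as Fin

sum-map-allFin : ∀ {n} (f : Fin n → ℕ) → List.sum (map f (allFin n)) ≡ ∑[ i < n ] f i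
sum-map-allFin f = trans (cong List.sum (map-tabulate id f)) (sum-tabulate f)

sum-map-concatMap : ∀ {A : Set} (h : ℕ → ℕ) (F : A → List ℕ) xs →
                    List.sum (map h (concatMap F xs)) ≡ List.sum (map (λ x → List.sum (map h (F x))) xs)
sum-map-concatMap h F [] = refl
sum-map-concatMap h F (x ∷ xs) = begin
  List.sum (map h (F x ++ concatMap F xs))         ≡⟨ cong List.sum (map-++ h (F x) (concatMap F xs)) ⟩
  List.sum (map h (F x) ++ map h (concatMap F xs)) ≡⟨ sum-++ (map h (F x)) (map h (concatMap F xs)) ⟩
  List.sum (map h (F x)) + List.sum (map h (concatMap F xs)) ≡⟨ cong (List.sum (map h (F x)) +_) (sum-map-concatMap h F xs) ⟩
  List.sum (map h (F x)) + List.sum (map (λ x → List.sum (map h (F x))) xs) ∎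
  where open ≡-Reasoning

deg-∑ : ∀ {N} (G : Graph N) x → deg G x ≡ ∑[ y < N ] χ (G x y)
deg-∑ G x = sum-map-allFin (χ ∘ G x)

edgeWeight : ∀ {N} → Graph N → Fin N → Fin N → ℕ
edgeWeight G x y = deg G x * deg G x + deg G y * deg G y

onEdges : ∀ {N} → (ℕ → ℕ) → Graph N → Fin N → Fin N → ℕ
onEdges h G x y = h (edgeWeight G x y) when G x y

onEdges-edge : ∀ {N} h (G : Graph N) {x y} → G x y ≡ true → onEdges h G x y ≡ h (edgeWeight G x y)
onEdges-edge h G {x} {y} x~y = cong (h (edgeWeight G x y) when_) x~y

onEdges-non-edge : ∀ {N} h (G : Graph N) {x y} → G x y ≡ false → onEdges h G x y ≡ 0
onEdges-non-edge h G {x} {y} x≁y = cong (h (edgeWeight G x y) when_) x≁y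

onEdges-sym : ∀ {N} h {G : Graph N} → (∀ x y → G x y ≡ G y x) → ∀ x y → onEdges h G x y ≡ onEdges h G y x
onEdges-sym h {G} G-sym x y = cong₂ (λ w b → h w when b) (+-comm (deg G x * deg G x) (deg G y * deg G y)) (G-sym x y)

sum-map-if-singleton : ∀ (h : ℕ → ℕ) b e → List.sum (map h (if b then e ∷ [] else [])) ≡ h e when b
sum-map-if-singleton h true e = +-identityʳ (h e)
sum-map-if-singleton h false e = refl

sum-edgeTerms : ∀ {N} (h : ℕ → ℕ) (G : Graph N) → List.sum (map h (edgeTerms G)) ≡ pairSum (onEdges h G)
sum-edgeTerms {N} h G = begin
  List.sum (map h (edgeTerms G))                            ≡⟨ sum-map-concatMap h row (allFin N) ⟩
  List.sum (map (λ x → List.sum (map h (row x))) (allFin N)) ≡⟨ sum-map-allFin (λ x → List.sum (map h (row x))) ⟩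
  ∑[ x < N ] List.sum (map h (row x))                        ≡⟨ sum-cong-≗ row-sum ⟩
  pairSum (onEdges h G)                                      ∎
  where
  open ≡-Reasoning
  cell : Fin N → Fin N → List ℕ
  cell x y = if G x y ∧ x ≺ y then edgeWeight G x y ∷ [] else []
  row : Fin N → List ℕ
  row x = concatMap (cell x) (allFin N)
  cell-sum : ∀ {x} y → List.sum (map h (cell x y)) ≡ onEdges h G x y when x ≺ y
  cell-sum {x} y = trans (sum-map-if-singleton h (G x y ∧ x ≺ y) (edgeWeight G x y)) (when-∧ _ (G x y) (x ≺ y))
  row-sum : ∀ x → List.sum (map h (row x)) ≡ ∑[ y < N ] (onEdges h G x y when x ≺ y)
  row-sum x = begin
    List.sum (map h (row x))                                    ≡⟨ sum-map-concatMap h (cell x) (allFin N) ⟩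
    List.sum (map (λ y → List.sum (map h (cell x y))) (allFin N)) ≡⟨ sum-map-allFin (λ y → List.sum (map h (cell x y))) ⟩
    ∑[ y < N ] List.sum (map h (cell x y))                        ≡⟨ sum-cong-≗ cell-sum ⟩
    ∑[ y < N ] (onEdges h G x y when x ≺ y)                       ∎

SO<-at-scale : ∀ {N} (G H : Graph N) K →
               pairSum (onEdges (suc ∘ root K) G) < pairSum (onEdges (root K) H) → SO< G H
SO<-at-scale G H K lt = K , subst₂ _<_ (sym (sum-edgeTerms (suc ∘ root K) G)) (sym (sum-edgeTerms (root K) H)) lt

-- Moving the neighbours of v other than v₁, v₂ to u

transform-sym : ∀ {N} {G : Graph N} → (∀ x y → G x y ≡ G y x) →
                ∀ u v v₁ v₂ x y → transform G u v v₁ v₂ x y ≡ transform G u v v₁ v₂ y x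
transform-sym {G = G} G-sym u v v₁ v₂ x y =
  cong₂ _∨_ (cong₂ (λ g b → g ∧ not b) (G-sym x y) (∨-comm (x ≡ᵇ v ∧ m y) (y ≡ᵇ v ∧ m x)))
            (∨-comm (x ≡ᵇ u ∧ m y) (y ≡ᵇ u ∧ m x))
  where m = moved G v v₁ v₂

module MoveNeighbours {N} (G : Graph N) (G-sym : ∀ x y → G x y ≡ G y x) (G-irrefl : ∀ x → G x x ≡ false)
              {u v v₁ v₂ : Fin N} (u≢v : u ≢ v) (u≁v : G u v ≡ false)
              (no-common-neighbour : ∀ z → G u z ≡ true → G v z ≡ false)
              (u-neighbours-small : ∀ z → G u z ≡ true → deg G z ≤ 2)
              (3≤deg-u : 3 ≤ deg G u) (3≤deg-v : 3 ≤ deg G v) (deg-v≤deg-u : deg G v ≤ deg G u) where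

  G* : Graph N
  G* = transform G u v v₁ v₂

  moving : Fin N → Bool
  moving = moved G v v₁ v₂

  moving⇒v-adj : ∀ {z} → moving z ≡ true → G v z ≡ true
  moving⇒v-adj = ∧-elimˡ

  moving⇒¬u-adj : ∀ {z} → moving z ≡ true → G u z ≡ false
  moving⇒¬u-adj {z} mz with G u z in u~z
  ... | true = trans (sym (moving⇒v-adj mz)) (no-common-neighbour z u~z)
  ... | false = refl

  ¬moving-u : moving u ≡ false
  ¬moving-u = cong (_∧ _) (trans (G-sym v u) u≁v)

  ¬moving-v : moving v ≡ false
  ¬moving-v = cong (_∧ _) (G-irrefl v)

  G*-u : ∀ z → G* u z ≡ G u z ∨ moving z
  G*-u z rewrite ≡ᵇ-refl u | ≢⇒≡ᵇ-false u≢v | ¬moving-u | ∧-zeroʳ (z ≡ᵇ v) | ∧-zeroʳ (z ≡ᵇ u)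
               | ∧-identityʳ (G u z) | ∨-identityʳ (moving z) = refl

  G*-v : ∀ z → G* v z ≡ G v z ∧ not (moving z)
  G*-v z rewrite ≡ᵇ-refl v | ≢⇒≡ᵇ-false (u≢v ∘ sym) | ¬moving-v | ∧-zeroʳ (z ≡ᵇ v) | ∧-zeroʳ (z ≡ᵇ u)
               | ∨-identityʳ (moving z) | ∨-identityʳ (G v z ∧ not (moving z)) = refl

  G*-away : ∀ {x} y → x ≢ u → x ≢ v → G* x y ≡ (G x y ∧ not (y ≡ᵇ v ∧ moving x)) ∨ (y ≡ᵇ u ∧ moving x)
  G*-away y x≢u x≢v rewrite ≢⇒≡ᵇ-false x≢u | ≢⇒≡ᵇ-false x≢v = refl

  deg-G*-away : ∀ {z} → z ≢ u → z ≢ v → deg G* z ≡ deg G z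
  deg-G*-away {z} z≢u z≢v = +-cancelʳ-≡ (χ (moving z)) (deg G* z) (deg G z) (begin
    deg G* z + χ (moving z)
      ≡⟨ cong₂ _+_ (deg-∑ G* z) (sym (∑-χ-≡ᵇ-∧ v (moving z))) ⟩
    ∑[ y < N ] χ (G* z y) + ∑[ y < N ] χ (y ≡ᵇ v ∧ moving z)
      ≡⟨ ∑-distrib-+ (λ y → χ (G* z y)) (λ y → χ (y ≡ᵇ v ∧ moving z)) ⟨
    ∑[ y < N ] (χ (G* z y) + χ (y ≡ᵇ v ∧ moving z))
      ≡⟨ sum-cong-≗ reroute ⟩
    ∑[ y < N ] (χ (G z y) + χ (y ≡ᵇ u ∧ moving z))
      ≡⟨ ∑-distrib-+ (λ y → χ (G z y)) (λ y → χ (y ≡ᵇ u ∧ moving z)) ⟩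
    ∑[ y < N ] χ (G z y) + ∑[ y < N ] χ (y ≡ᵇ u ∧ moving z)
      ≡⟨ cong₂ _+_ (sym (deg-∑ G z)) (∑-χ-≡ᵇ-∧ u (moving z)) ⟩
    deg G z + χ (moving z) ∎)
    where
    open ≡-Reasoning
    reroute : ∀ y → χ (G* z y) + χ (y ≡ᵇ v ∧ moving z) ≡ χ (G z y) + χ (y ≡ᵇ u ∧ moving z)
    reroute y rewrite G*-away y z≢u z≢v = χ-reroute (G z y) (y ≡ᵇ v ∧ moving z) (y ≡ᵇ u ∧ moving z) to-v to-u
      where
      to-v : (y ≡ᵇ v ∧ moving z) ≡ true → G z y ≡ true
      to-v e with ≡ᵇ⇒≡ {x = y} {v} (∧-elimˡ e)
      ... | refl = trans (G-sym z v) (moving⇒v-adj (∧-elimʳ {v ≡ᵇ v} e))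
      to-u : (y ≡ᵇ u ∧ moving z) ≡ true → G z y ≡ false
      to-u e with ≡ᵇ⇒≡ {x = y} {u} (∧-elimˡ e)
      ... | refl = trans (G-sym z u) (moving⇒¬u-adj (∧-elimʳ {u ≡ᵇ u} e))

  #moved : ℕ
  #moved = ∑[ z < N ] χ (moving z)

  deg-G*-u : deg G* u ≡ deg G u + #moved
  deg-G*-u = begin
    deg G* u
      ≡⟨ deg-∑ G* u ⟩
    ∑[ z < N ] χ (G* u z)
      ≡⟨ sum-cong-≗ (λ z → trans (cong χ (G*-u z)) (χ-∨ (G u z) (moving z) moving⇒¬u-adj)) ⟩
    ∑[ z < N ] (χ (G u z) + χ (moving z))
      ≡⟨ ∑-distrib-+ (λ z → χ (G u z)) (λ z → χ (moving z)) ⟩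
    ∑[ z < N ] χ (G u z) + #moved
      ≡⟨ cong (_+ #moved) (deg-∑ G u) ⟨
    deg G u + #moved ∎
    where open ≡-Reasoning

  deg-G-v : deg G v ≡ deg G* v + #moved
  deg-G-v = begin
    deg G v
      ≡⟨ deg-∑ G v ⟩
    ∑[ z < N ] χ (G v z)
      ≡⟨ sum-cong-≗ (λ z → trans (χ-∧-not (G v z) (moving z) moving⇒v-adj)
                                 (sym (cong (λ b → χ b + χ (moving z)) (G*-v z)))) ⟩
    ∑[ z < N ] (χ (G* v z) + χ (moving z))
      ≡⟨ ∑-distrib-+ (λ z → χ (G* v z)) (λ z → χ (moving z)) ⟩
    ∑[ z < N ] χ (G* v z) + #moved
      ≡⟨ cong (_+ #moved) (deg-∑ G* v) ⟨
    deg G* v + #moved ∎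
    where open ≡-Reasoning

  deg-G*-v≤2 : deg G* v ≤ 2
  deg-G*-v≤2 = begin
    deg G* v                                          ≡⟨ deg-∑ G* v ⟩
    ∑[ z < N ] χ (G* v z)                              ≤⟨ ∑-mono-≤ kept ⟩
    ∑[ z < N ] (χ (z ≡ᵇ v₁) + χ (z ≡ᵇ v₂))            ≡⟨ ∑-distrib-+ (λ z → χ (z ≡ᵇ v₁)) (λ z → χ (z ≡ᵇ v₂)) ⟩
    ∑[ z < N ] χ (z ≡ᵇ v₁) + ∑[ z < N ] χ (z ≡ᵇ v₂)   ≡⟨ cong₂ _+_ (∑-when-≡ᵇ v₁ 1) (∑-when-≡ᵇ v₂ 1) ⟩
    2                                                 ∎
    where
    open ≤-Reasoning
    kept : ∀ z → χ (G* v z) ≤ χ (z ≡ᵇ v₁) + χ (z ≡ᵇ v₂)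
    kept z rewrite G*-v z = χ-kept-≤ (G v z) (z ≡ᵇ v₁) (z ≡ᵇ v₂)

  1≤#moved : 1 ≤ #moved
  1≤#moved = +-cancelˡ-≤ 2 1 #moved (begin
    3                   ≤⟨ 3≤deg-v ⟩
    deg G v             ≡⟨ deg-G-v ⟩
    deg G* v + #moved   ≤⟨ +-monoˡ-≤ #moved deg-G*-v≤2 ⟩
    2 + #moved          ∎)
    where open ≤-Reasoning

  G*-outside : ∀ {x y} → x ≢ u → x ≢ v → y ≢ u → y ≢ v → G* x y ≡ G x y
  G*-outside {x} {y} x≢u x≢v y≢u y≢v rewrite G*-away y x≢u x≢v | ≢⇒≡ᵇ-false y≢u | ≢⇒≡ᵇ-false y≢v
    | ∧-identityʳ (G x y) | ∨-identityʳ (G x y) = refl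

  adj-≢ : ∀ {x y z} → G x z ≡ true → G x y ≡ false → z ≢ y
  adj-≢ x~z x≁y refl = contradiction (trans (sym x~z) x≁y) λ ()

  deg-G*-u-nbr : ∀ {z} → G u z ≡ true → deg G* z ≡ deg G z
  deg-G*-u-nbr u~z = deg-G*-away (adj-≢ u~z (G-irrefl u)) (adj-≢ u~z u≁v)

  deg-G*-v-nbr : ∀ {z} → G v z ≡ true → deg G* z ≡ deg G z
  deg-G*-v-nbr v~z = deg-G*-away (adj-≢ v~z (trans (G-sym v u) u≁v)) (adj-≢ v~z (G-irrefl v))

  weight-G*-u : ∀ {z} → deg G* z ≡ deg G z →
                edgeWeight G* u z ≡ (deg G u + #moved) * (deg G u + #moved) + deg G z * deg G z
  weight-G*-u = cong₂ (λ a b → a * a + b * b) deg-G*-u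

  -- Per unit of M: each of the m ≥ 3 edges at u gains 5q, each of the ≤ 2 edges kept at v loses
  -- at most 6q, and rounding loses at most N + N² < M in total.
  M K gain : ℕ
  M = suc (N + N * N)
  K = 6 * M
  gain = 5 * M * #moved

  before after : Fin N → Fin N → ℕ
  before = onEdges (suc ∘ root K) G
  after = onEdges (root K) G*

  before-on : ∀ {x y} → G x y ≡ true → before x y ≡ suc (root K (edgeWeight G x y))
  before-on = onEdges-edge (suc ∘ root K) G

  before-off : ∀ {x y} → G x y ≡ false → before x y ≡ 0
  before-off = onEdges-non-edge (suc ∘ root K) G

  after-on : ∀ {x y} → G* x y ≡ true → after x y ≡ root K (edgeWeight G* x y)
  after-on = onEdges-edge (root K) G*

  after-off : ∀ {x y} → G* x y ≡ false → after x y ≡ 0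
  after-off = onEdges-non-edge (root K) G*

  star-before star-after : Fin N → ℕ
  star-before z = before u z + before v z + (gain when G u z)
  star-after z = after u z + after v z + suc (#moved * K when G* v z)

  star-before-off-u : ∀ {z} → G u z ≡ false → G v z ≡ true → star-before z ≡ suc (root K (edgeWeight G v z))
  star-before-off-u {z} u≁z v~z = begin
    before u z + before v z + (gain when G u z)
      ≡⟨ cong₂ _+_ (cong₂ _+_ (before-off u≁z) (before-on v~z)) (cong (gain when_) u≁z) ⟩
    suc (root K (edgeWeight G v z)) + 0
      ≡⟨ +-identityʳ (suc (root K (edgeWeight G v z))) ⟩
    suc (root K (edgeWeight G v z)) ∎
    where open ≡-Reasoning

  ≤-star-after : ∀ {z n} → n ≤ after u z + after v z + (#moved * K when G* v z) → suc n ≤ star-after z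
  ≤-star-after le = ≤-trans (s≤s le) (≤-reflexive (sym (+-suc _ _)))

  u-edge : ∀ {z} → G u z ≡ true → star-before z ≤ star-after z
  u-edge {z} u~z = begin
    before u z + before v z + (gain when G u z)
      ≡⟨ cong₂ _+_ (cong₂ _+_ (before-on u~z) (before-off (no-common-neighbour z u~z))) (cong (gain when_) u~z) ⟩
    suc (root K (edgeWeight G u z)) + 0 + gain
      ≡⟨ cong (_+ gain) (+-identityʳ (suc (root K (edgeWeight G u z)))) ⟩
    suc (root K (deg G u * deg G u + deg G z * deg G z) + gain)
      ≤⟨ s≤s (root-+-≥ M 3≤deg-u 1≤#moved (u-neighbours-small z u~z)) ⟩
    suc (root K ((deg G u + #moved) * (deg G u + #moved) + deg G z * deg G z))
      ≡⟨ cong (suc ∘ root K) (weight-G*-u (deg-G*-u-nbr u~z)) ⟨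
    suc (root K (edgeWeight G* u z))
      ≡⟨ cong suc (after-on (trans (G*-u z) (cong (_∨ moving z) u~z))) ⟨
    suc (after u z)
      ≤⟨ ≤-star-after (≤-trans (m≤m+n (after u z) (after v z)) (m≤m+n _ _)) ⟩
    star-after z ∎
    where open ≤-Reasoning

  moved-edge : ∀ {z} → G u z ≡ false → moving z ≡ true → star-before z ≤ star-after z
  moved-edge {z} u≁z mz = begin
    star-before z
      ≡⟨ star-before-off-u u≁z v~z ⟩
    suc (root K (deg G v * deg G v + deg G z * deg G z))
      ≤⟨ s≤s (isqrt-mono-≤ (*-monoˡ-≤ (K * K) (+-monoˡ-≤ (deg G z * deg G z) (*-mono-≤ n≤m+q n≤m+q)))) ⟩
    suc (root K ((deg G u + #moved) * (deg G u + #moved) + deg G z * deg G z))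
      ≡⟨ cong (suc ∘ root K) (weight-G*-u (deg-G*-v-nbr v~z)) ⟨
    suc (root K (edgeWeight G* u z))
      ≡⟨ cong suc (after-on (trans (G*-u z) (cong₂ _∨_ u≁z mz))) ⟨
    suc (after u z)
      ≤⟨ ≤-star-after (≤-trans (m≤m+n (after u z) (after v z)) (m≤m+n _ _)) ⟩
    star-after z ∎
    where
    open ≤-Reasoning
    v~z : G v z ≡ true
    v~z = moving⇒v-adj mz
    n≤m+q : deg G v ≤ deg G u + #moved
    n≤m+q = ≤-trans deg-v≤deg-u (m≤m+n (deg G u) #moved)

  kept-edge : ∀ {z} → G u z ≡ false → moving z ≡ false → G v z ≡ true → star-before z ≤ star-after z
  kept-edge {z} u≁z mz v~z = begin
    star-before z
      ≡⟨ star-before-off-u u≁z v~z ⟩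
    suc (root K (deg G v * deg G v + deg G z * deg G z))
      ≡⟨ cong (λ n → suc (root K (n * n + deg G z * deg G z))) deg-G-v ⟩
    suc (root K ((deg G* v + #moved) * (deg G* v + #moved) + deg G z * deg G z))
      ≤⟨ s≤s (root-+-≤ K (deg G* v) #moved (deg G z)) ⟩
    suc (root K (deg G* v * deg G* v + deg G z * deg G z) + #moved * K)
      ≡⟨ cong (λ d → suc (root K (deg G* v * deg G* v + d * d) + #moved * K)) (deg-G*-v-nbr v~z) ⟨
    suc (root K (edgeWeight G* v z) + #moved * K)
      ≡⟨ cong₂ (λ a b → suc (a + (#moved * K when b))) (after-on v*z) v*z ⟨
    suc (after v z + (#moved * K when G* v z))
      ≤⟨ ≤-star-after (+-monoˡ-≤ _ (m≤n+m (after v z) (after u z))) ⟩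
    star-after z ∎
    where
    open ≤-Reasoning
    v*z : G* v z ≡ true
    v*z = trans (G*-v z) (cong₂ (λ a b → a ∧ not b) v~z mz)

  no-edge : ∀ {z} → G u z ≡ false → G v z ≡ false → star-before z ≤ star-after z
  no-edge u≁z v≁z =
    ≤-trans (≤-reflexive (cong₂ _+_ (cong₂ _+_ (before-off u≁z) (before-off v≁z)) (cong (gain when_) u≁z))) z≤n

  star-≤ : ∀ z → star-before z ≤ star-after z
  star-≤ z = by-cases (G u z) refl (moving z) refl (G v z) refl
    where
    by-cases : ∀ a → G u z ≡ a → ∀ b → moving z ≡ b → ∀ c → G v z ≡ c → star-before z ≤ star-after z
    by-cases true  u~z _     _  _     _   = u-edge u~z
    by-cases false u≁z true  mz _     _   = moved-edge u≁z mz
    by-cases false u≁z false mz true  v~z = kept-edge u≁z mz v~z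
    by-cases false u≁z false _  false v≁z = no-edge u≁z v≁z

  ∑-star-before : ∑[ z < N ] star-before z ≡ ∑[ z < N ] before u z + ∑[ z < N ] before v z + deg G u * gain
  ∑-star-before = begin
    ∑[ z < N ] star-before z
      ≡⟨ ∑-distrib-+ (λ z → before u z + before v z) (λ z → gain when G u z) ⟩
    ∑[ z < N ] (before u z + before v z) + ∑[ z < N ] (gain when G u z)
      ≡⟨ cong₂ _+_ (∑-distrib-+ (before u) (before v)) (∑-when (G u) gain) ⟩
    ∑[ z < N ] before u z + ∑[ z < N ] before v z + ∑[ z < N ] χ (G u z) * gain
      ≡⟨ cong (λ n → ∑[ z < N ] before u z + ∑[ z < N ] before v z + n * gain) (deg-∑ G u) ⟨
    ∑[ z < N ] before u z + ∑[ z < N ] before v z + deg G u * gain ∎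
    where open ≡-Reasoning

  ∑-star-after : ∑[ z < N ] star-after z ≡ ∑[ z < N ] after u z + ∑[ z < N ] after v z + (N + deg G* v * (#moved * K))
  ∑-star-after = begin
    ∑[ z < N ] star-after z
      ≡⟨ ∑-distrib-+ (λ z → after u z + after v z) (λ z → suc (#moved * K when G* v z)) ⟩
    ∑[ z < N ] (after u z + after v z) + ∑[ z < N ] (1 + (#moved * K when G* v z))
      ≡⟨ cong₂ _+_ (∑-distrib-+ (after u) (after v)) (∑-distrib-+ (λ _ → 1) (λ z → #moved * K when G* v z)) ⟩
    ∑[ z < N ] after u z + ∑[ z < N ] after v z + (∑[ z < N ] 1 + ∑[ z < N ] (#moved * K when G* v z))
      ≡⟨ cong (∑[ z < N ] after u z + ∑[ z < N ] after v z +_) (cong₂ _+_ (trans (∑-const N 1) (*-identityʳ N))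
           (trans (∑-when (G* v) (#moved * K)) (sym (cong (_* (#moved * K)) (deg-∑ G* v))))) ⟩
    ∑[ z < N ] after u z + ∑[ z < N ] after v z + (N + deg G* v * (#moved * K)) ∎
    where open ≡-Reasoning

  before-split : pairSum before ≡ ∑[ z < N ] before u z + ∑[ z < N ] before v z + pairSum (away v (away u before))
  before-split = pairSum-star₂ before u≢v (onEdges-sym (suc ∘ root K) G-sym)
    (before-off (G-irrefl u)) (before-off (G-irrefl v)) (before-off u≁v)

  after-split : pairSum after ≡ ∑[ z < N ] after u z + ∑[ z < N ] after v z + pairSum (away v (away u after))
  after-split = pairSum-star₂ after u≢v (onEdges-sym (root K) (transform-sym G-sym u v v₁ v₂))
    (after-off (trans (G*-u u) (cong₂ _∨_ (G-irrefl u) ¬moving-u)))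
    (after-off (trans (G*-v v) (cong (_∧ not (moving v)) (G-irrefl v))))
    (after-off (trans (G*-u v) (cong₂ _∨_ u≁v ¬moving-v)))

  outside-≤ : ∀ x y → away v (away u before) x y ≤ away v (away u after) x y + 1
  outside-≤ x y = away-≤-+1 {a = away u before} {away u after} v x y λ x≢v y≢v →
                  away-≤-+1 {a = before} {after} u x y λ x≢u y≢u →
    subst (λ n → before x y ≤ n + 1)
      (sym (cong₂ (λ w b → root K w when b) (cong₂ (λ a b → a * a + b * b) (deg-G*-away x≢u x≢v) (deg-G*-away y≢u y≢v))
                                           (G*-outside x≢u x≢v y≢u y≢v)))
      (suc-when-≤ (root K (edgeWeight G x y)) (G x y))

  before<after : pairSum before < pairSum after
  before<after = +-cancelʳ-< (deg G u * gain) (pairSum before) (pairSum after) (begin-strict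
    pairSum before + deg G u * gain
      ≡⟨ cong (_+ deg G u * gain) before-split ⟩
    ∑-before-at-u,v + outside-before + deg G u * gain
      ≡⟨ xy∙z≈xz∙y ∑-before-at-u,v outside-before (deg G u * gain) ⟩
    ∑-before-at-u,v + deg G u * gain + outside-before
      ≡⟨ cong (_+ outside-before) ∑-star-before ⟨
    ∑[ z < N ] star-before z + outside-before
      ≤⟨ +-mono-≤ (∑-mono-≤ star-≤) (pairSum-≤-+1 outside-≤) ⟩
    ∑[ z < N ] star-after z + (outside-after + N * N)
      ≡⟨ cong (_+ (outside-after + N * N)) ∑-star-after ⟩
    ∑-after-at-u,v + slack + (outside-after + N * N)
      ≡⟨ interchange ∑-after-at-u,v slack outside-after (N * N) ⟩
    ∑-after-at-u,v + outside-after + (slack + N * N)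
      ≡⟨ cong (_+ (slack + N * N)) after-split ⟨
    pairSum after + (slack + N * N)
      <⟨ +-monoʳ-< (pairSum after) budget ⟩
    pairSum after + deg G u * gain ∎)
    where
    open ≤-Reasoning
    ∑-before-at-u,v = ∑[ z < N ] before u z + ∑[ z < N ] before v z
    ∑-after-at-u,v = ∑[ z < N ] after u z + ∑[ z < N ] after v z
    outside-before = pairSum (away v (away u before))
    outside-after = pairSum (away v (away u after))
    slack = N + deg G* v * (#moved * K)
    budget : slack + N * N < deg G u * gain
    budget = begin-strict
      N + deg G* v * (#moved * K) + N * N   ≡⟨ xy∙z≈xz∙y N (deg G* v * (#moved * K)) (N * N) ⟩
      N + N * N + deg G* v * (#moved * K)   <⟨ rounding-budget (N + N * N) 3≤deg-u deg-G*-v≤2 1≤#moved ⟩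
      deg G u * gain                        ∎

  SO<-transform : SO< G G*
  SO<-transform = SO<-at-scale G G* K before<after

adjacent-dist : ∀ {N} {G : Graph N} {x y} → G x y ≡ true → x ≢ y → HasDist G x y 1
adjacent-dist x~y x≢y = step x~y here , λ { zero here → contradiction refl x≢y ; (suc j) _ → s≤s z≤n }

lemma2p6 : (N : ℕ) (T : Graph N) → IsTree T →
    (u v : Fin N) (k : ℕ) →
    3 ≤ deg T u → 3 ≤ deg T v → u ≢ v →
    HasDist T u v k → 3 ≤ k →
    (∀ (w : Fin N) (j : ℕ) → w ≢ u → 3 ≤ deg T w → HasDist T u w j → k ≤ j) →
    (v2 : Fin N) → T v v2 ≡ true → HasDist T u v2 (k ∸ 1) →
    (v1 : Fin N) → T v v1 ≡ true → v1 ≢ v2 →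
    deg T v ≤ deg T u →
    SO< T (transform T u v v1 v2)
lemma2p6 N T ((T-sym , T-irrefl) , _) u v k 3≤deg-u 3≤deg-v u≢v (_ , shortest) 3≤k nearest v₂ _ _ v₁ _ _ deg-v≤deg-u =
  MoveNeighbours.SO<-transform T T-sym T-irrefl {u} {v} {v₁} {v₂} u≢v u≁v no-common-neighbour u-neighbours-small
    3≤deg-u 3≤deg-v deg-v≤deg-u
  where
  3≰2 : ¬ 3 ≤ 2
  3≰2 (s≤s (s≤s ()))
  u≁v : T u v ≡ false
  u≁v = ¬-not λ u~v → 3≰2 (≤-trans 3≤k (≤-trans (shortest 1 (step u~v here)) (n≤1+n 1)))
  no-common-neighbour : ∀ z → T u z ≡ true → T v z ≡ false
  no-common-neighbour z u~z = ¬-not λ v~z → 3≰2 (≤-trans 3≤k (shortest 2 (step u~z (step (trans (T-sym z v) v~z) here))))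
  u-neighbours-small : ∀ z → T u z ≡ true → deg T z ≤ 2
  u-neighbours-small z u~z = ≮⇒≥ λ 3≤deg-z →
    3≰2 (≤-trans 3≤k (≤-trans (nearest z 1 z≢u 3≤deg-z (adjacent-dist u~z (z≢u ∘ sym))) (n≤1+n 1)))
    where
    z≢u : z ≢ u
    z≢u refl = contradiction (trans (sym u~z) (T-irrefl u)) λ ()
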